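{- Let $(v_i)_{i\in\mathbb{Z}}$ be a twisted $n$-gon in $\mathbb{RP}^2$ whose vertices lie on a non-degenerate conic $C$, and whose corner invariants $x_i,y_i$ and the quantities below are defined. Identify $C$ with $\mathbb{RP}^1$ (via stereographic projection from a point of $C$), so that cross ratios of points of $C$ are well defined, and set $p_i=1-[v_{i-2},v_{i-1},v_i,v_{i+1}]$. Then $$x_i=[v_{i-2},v_{i-1},v_i,v_{i+2}],\qquad y_i=[v_{i-2},v_i,v_{i+1},v_{i+2}],$$ and $$x_i=\frac{1-p_i}{p_{i+1}},\qquad y_i=\frac{1-p_{i+1}}{p_i}.$$
   Context: A twisted $n$-gon is a sequence of points $v_i\in\mathbb{RP}^2$, $i\in\mathbb{Z}$, with a projective transformation $M$ such that $v_{i+n}=M(v_i)$ for all $i$. The cross ratio is $[t_1,t_2,t_3,t_4]=\frac{(t_1-t_2)(t_3-t_4)}{(t_1-t_3)(t_2-t_4)}$; for points on $C\cong\mathbb{RP}^1$ it is computed in an affine coordinate on $\mathbb{RP}^1$ (it does not depend on the choice of identification). Writing $(a,b)$ for the line through $a,b$, the corner invariants are $x_i=[v_{i-2},v_{i-1},(v_{i-2},v_{i-1})\cap(v_i,v_{i+1}),(v_{i-2},v_{i-1})\cap(v_{i+1},v_{i+2})]$ and $y_i=[v_{i+2},v_{i+1},(v_{i+2},v_{i+1})\cap(v_i,v_{i-1}),(v_{i+2},v_{i+1})\cap(v_{i-1},v_{i-2})]$, cross ratios of four collinear points. -}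

module Defs where

open import Level using (0ℓ)
open import Algebra.Bundles using (CommutativeRing)
open import Relation.Binary.Structures using (IsTotalOrder)
open import Relation.Nullary using (¬_)
open import Data.Product using (_×_; _,_; ∃; Σ)
open import Data.Nat using (ℕ)
open import Data.Integer as ℤ using (ℤ)

-- The real numbers, given axiomatically: a complete ordered field.
-- (agda-stdlib has no real numbers.)  The inverse is a total function;
-- its value at 0 is irrelevant, it is only used where the denominator
-- is assumed nonzero.

record RealField : Set₁ where
  field
    commRing : CommutativeRing 0ℓ 0ℓ
  open CommutativeRing commRing public
  infix 8 _⁻¹
  infix 4 _≤_
  field
    _⁻¹        : Carrier → Carrier
    ⁻¹-inverse : ∀ x → ¬ (x ≈ 0#) → x * x ⁻¹ ≈ 1#
    0≉1        : ¬ (0# ≈ 1#)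
    _≤_        : Carrier → Carrier → Set
    isTotalOrder : IsTotalOrder _≈_ _≤_
    +-mono-≤   : ∀ {x y} z → x ≤ y → x + z ≤ y + z
    *-nonneg   : ∀ {x y} → 0# ≤ x → 0# ≤ y → 0# ≤ x * y
    lub : (S : Carrier → Set) → (∃ λ x → S x) → (∃ λ b → ∀ x → S x → x ≤ b) →
          ∃ λ s → (∀ x → S x → x ≤ s) × (∀ b → (∀ x → S x → x ≤ b) → s ≤ b)

-- A point of RP² is represented by a nonzero vector of R³ (up to scaling),
-- a line by a nonzero vector of R³ (its normal / dual coordinates).

module Geo (R : RealField) where
  open RealField R public

  V3 : Set
  V3 = Carrier × Carrier × Carrier

  infix 4 _≈v_
  _≈v_ : V3 → V3 → Set
  (a₁ , a₂ , a₃) ≈v (b₁ , b₂ , b₃) = (a₁ ≈ b₁) × (a₂ ≈ b₂) × (a₃ ≈ b₃)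

  𝟎 : V3
  𝟎 = 0# , 0# , 0#

  dot : V3 → V3 → Carrier
  dot (a₁ , a₂ , a₃) (b₁ , b₂ , b₃) = a₁ * b₁ + a₂ * b₂ + a₃ * b₃

  cross : V3 → V3 → V3
  cross (a₁ , a₂ , a₃) (b₁ , b₂ , b₃) =
    (a₂ * b₃ - a₃ * b₂) , (a₃ * b₁ - a₁ * b₃) , (a₁ * b₂ - a₂ * b₁)

  det3 : V3 → V3 → V3 → Carrier
  det3 a b c = dot a (cross b c)

  Mat3 : Set
  Mat3 = V3 × V3 × V3

  apply : Mat3 → V3 → V3
  apply (r₁ , r₂ , r₃) v = dot r₁ v , dot r₂ v , dot r₃ v

  detM : Mat3 → Carrier
  detM (r₁ , r₂ , r₃) = det3 r₁ r₂ r₃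

  transpose : Mat3 → Mat3
  transpose ((a , b , c) , (d , e , f) , (g , h , i)) =
    (a , d , g) , (b , e , h) , (c , f , i)

  infix 4 _≈m_
  _≈m_ : Mat3 → Mat3 → Set
  (r₁ , r₂ , r₃) ≈m (s₁ , s₂ , s₃) = (r₁ ≈v s₁) × (r₂ ≈v s₂) × (r₃ ≈v s₃)

  quad : Mat3 → V3 → Carrier
  quad Q v = dot v (apply Q v)

  infixl 7 _/_
  _/_ : Carrier → Carrier → Carrier
  x / y = x * y ⁻¹

  SamePoint : V3 → V3 → Set
  SamePoint a b = cross a b ≈v 𝟎

  line : V3 → V3 → V3
  line = cross

  meet : V3 → V3 → V3
  meet = cross

  -- Cross ratio [p₁,p₂,p₃,p₄] = (t₁-t₂)(t₃-t₄)/((t₁-t₃)(t₂-t₄)) of four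
  -- points on the line L, in homogeneous form: for points p,q on L one has
  -- p × q = c·L, and det3 L p q = c·|L|², which is (up to a common factor
  -- that cancels) the difference t_q - t_p of affine coordinates on L.
  crLineDen : V3 → V3 → V3 → V3 → V3 → Carrier
  crLineDen L p₁ p₂ p₃ p₄ = det3 L p₁ p₃ * det3 L p₂ p₄

  crLine : V3 → V3 → V3 → V3 → V3 → Carrier
  crLine L p₁ p₂ p₃ p₄ = (det3 L p₁ p₂ * det3 L p₃ p₄) / crLineDen L p₁ p₂ p₃ p₄

  -- Cross ratio of four points of a conic C, computed through stereographic
  -- projection from a point O of C (O different from the four points):
  -- the affine coordinate difference t_q - t_p of the projections is, up to a
  -- factor that cancels, det3 O p q.
  crConicDen : V3 → V3 → V3 → V3 → V3 → Carrier
  crConicDen O p₁ p₂ p₃ p₄ = det3 O p₁ p₃ * det3 O p₂ p₄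

  crConic : V3 → V3 → V3 → V3 → V3 → Carrier
  crConic O p₁ p₂ p₃ p₄ = (det3 O p₁ p₂ * det3 O p₃ p₄) / crConicDen O p₁ p₂ p₃ p₄

  _⟨_⟩ : (ℤ → V3) → ℤ → ℤ → V3
  (v ⟨ i ⟩) k = v (i ℤ.+ k)

  IsTwistedNGon : ℕ → (ℤ → V3) → Mat3 → Set
  IsTwistedNGon n v M =
    (∀ i → ¬ (v i ≈v 𝟎)) × ¬ (detM M ≈ 0#) ×
    (∀ i → SamePoint (v (i ℤ.+ ℤ.+ n)) (apply M (v i)))

  IsNondegConic : Mat3 → Set
  IsNondegConic Q = (Q ≈m transpose Q) × ¬ (detM Q ≈ 0#)

  OnConic : Mat3 → V3 → Set
  OnConic Q p = quad Q p ≈ 0#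

  xInv : (ℤ → V3) → ℤ → Carrier
  xInv v i =
    let w = v ⟨ i ⟩
        L = line (w (ℤ.- ℤ.+ 2)) (w (ℤ.- ℤ.+ 1))
    in crLine L (w (ℤ.- ℤ.+ 2)) (w (ℤ.- ℤ.+ 1))
         (meet L (line (w (ℤ.+ 0)) (w (ℤ.+ 1))))
         (meet L (line (w (ℤ.+ 1)) (w (ℤ.+ 2))))

  xInvDen : (ℤ → V3) → ℤ → Carrier
  xInvDen v i =
    let w = v ⟨ i ⟩
        L = line (w (ℤ.- ℤ.+ 2)) (w (ℤ.- ℤ.+ 1))
    in crLineDen L (w (ℤ.- ℤ.+ 2)) (w (ℤ.- ℤ.+ 1))
         (meet L (line (w (ℤ.+ 0)) (w (ℤ.+ 1))))
         (meet L (line (w (ℤ.+ 1)) (w (ℤ.+ 2))))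

  yInv : (ℤ → V3) → ℤ → Carrier
  yInv v i =
    let w = v ⟨ i ⟩
        L = line (w (ℤ.+ 2)) (w (ℤ.+ 1))
    in crLine L (w (ℤ.+ 2)) (w (ℤ.+ 1))
         (meet L (line (w (ℤ.+ 0)) (w (ℤ.- ℤ.+ 1))))
         (meet L (line (w (ℤ.- ℤ.+ 1)) (w (ℤ.- ℤ.+ 2))))

  yInvDen : (ℤ → V3) → ℤ → Carrier
  yInvDen v i =
    let w = v ⟨ i ⟩
        L = line (w (ℤ.+ 2)) (w (ℤ.+ 1))
    in crLineDen L (w (ℤ.+ 2)) (w (ℤ.+ 1))
         (meet L (line (w (ℤ.+ 0)) (w (ℤ.- ℤ.+ 1))))
         (meet L (line (w (ℤ.- ℤ.+ 1)) (w (ℤ.- ℤ.+ 2))))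

  crA : V3 → (ℤ → V3) → ℤ → Carrier
  crA O v i = let w = v ⟨ i ⟩ in
    crConic O (w (ℤ.- ℤ.+ 2)) (w (ℤ.- ℤ.+ 1)) (w (ℤ.+ 0)) (w (ℤ.+ 1))
  crADen : V3 → (ℤ → V3) → ℤ → Carrier
  crADen O v i = let w = v ⟨ i ⟩ in
    crConicDen O (w (ℤ.- ℤ.+ 2)) (w (ℤ.- ℤ.+ 1)) (w (ℤ.+ 0)) (w (ℤ.+ 1))

  crB : V3 → (ℤ → V3) → ℤ → Carrier
  crB O v i = let w = v ⟨ i ⟩ in
    crConic O (w (ℤ.- ℤ.+ 2)) (w (ℤ.- ℤ.+ 1)) (w (ℤ.+ 0)) (w (ℤ.+ 2))
  crBDen : V3 → (ℤ → V3) → ℤ → Carrier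
  crBDen O v i = let w = v ⟨ i ⟩ in
    crConicDen O (w (ℤ.- ℤ.+ 2)) (w (ℤ.- ℤ.+ 1)) (w (ℤ.+ 0)) (w (ℤ.+ 2))

  crC : V3 → (ℤ → V3) → ℤ → Carrier
  crC O v i = let w = v ⟨ i ⟩ in
    crConic O (w (ℤ.- ℤ.+ 2)) (w (ℤ.+ 0)) (w (ℤ.+ 1)) (w (ℤ.+ 2))
  crCDen : V3 → (ℤ → V3) → ℤ → Carrier
  crCDen O v i = let w = v ⟨ i ⟩ in
    crConicDen O (w (ℤ.- ℤ.+ 2)) (w (ℤ.+ 0)) (w (ℤ.+ 1)) (w (ℤ.+ 2))

  pInv : V3 → (ℤ → V3) → ℤ → Carrier
  pInv O v i = 1# - crA O v i

  AllDefined : V3 → (ℤ → V3) → Set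
  AllDefined O v = ∀ i →
    ¬ (xInvDen v i ≈ 0#) × ¬ (yInvDen v i ≈ 0#) ×
    ¬ (crADen O v i ≈ 0#) × ¬ (crBDen O v i ≈ 0#) × ¬ (crCDen O v i ≈ 0#) ×
    ¬ (pInv O v i ≈ 0#)

{-# OPTIONS --safe #-}
module Submission where

open import Defs
open import Level using (0ℓ)
open import Algebra.Bundles using (CommutativeRing)
open import Data.Nat as ℕ using (ℕ; zero; suc)
import Data.Nat.Properties as ℕ
open import Data.Integer as ℤ using (ℤ; +_; -[1+_]; _⊖_; _◃_)
import Data.Integer.Properties as ℤ
open import Data.Sign as Sign using (Sign)
open import Data.Maybe using (Maybe; just; nothing)
open import Data.Product using (_×_; _,_)
open import Function using (_∘_)
open import Relation.Binary.PropositionalEquality as ≡ using (_≡_)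
open import Relation.Nullary using (¬_)
open import Relation.Nullary.Decidable using (yes; no)

-- Write [xyz] for det3 x y z and (a, b, c, d, e) for (v_{i-2}, ..., v_{i+2}).  Computing on the
-- line (a, b), the Binet-Cauchy identity for cross products gives
-- x_i = ([acd][bde] - [ade][bcd]) / ([acd][bde]), with no reference to the conic.  For points of
-- a nondegenerate conic with polar form B, comparing two Gram determinants gives
-- [yxz][Oyz] B(O,x) = [Oyx][Oxz] B(y,z); this yields Steiner's theorem that the cross ratio of
-- four points of the conic is the same seen from d as seen from O, so
-- [ade][bcd] / ([acd][bde]) = [Oae][Obc] / ([Oac][Obe]), and a Plücker relation turns
-- x_i into [v_{i-2}, v_{i-1}, v_i, v_{i+2}].  Reversing the indices handles y_i, and the formulas
-- in terms of p_i are identities between cross ratios of five points of the pencil through O.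

-- Coefficients in ℤ, rather than in the abstract carrier, let the normaliser detect cancellations.
module ℤ-CoefficientSolver (R : CommutativeRing 0ℓ 0ℓ) where
  open CommutativeRing R
  open import Algebra.Properties.Ring ring using (-‿involutive; -0#≈0#; -‿distribˡ-*; -‿distribʳ-*)
  open import Algebra.Properties.AbelianGroup +-abelianGroup using (⁻¹-∙-comm)
  open import Algebra.Properties.CommutativeSemigroup +-commutativeSemigroup using (interchange)
  open import Algebra.Properties.Semiring.Mult.TCOptimised semiring using (×1-homo-*; ×-homo-+) renaming (_×_ to _·_)
  open import Relation.Binary.Reasoning.Setoid setoid
  open import Algebra.Solver.Ring.AlmostCommutativeRing using (fromCommutativeRing; _-Raw-AlmostCommutative⟶_)

  ⟦_⟧ℤ : ℤ → Carrier
  ⟦ + n ⟧ℤ = n · 1#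
  ⟦ -[1+ n ] ⟧ℤ = - (suc n · 1#)

  suc-· : ∀ n → suc n · 1# ≈ 1# + n · 1#
  suc-· n = ×-homo-+ 1# 1 n

  ⊖-homo : ∀ m n → ⟦ m ⊖ n ⟧ℤ ≈ m · 1# - n · 1#
  ⊖-homo m zero = begin
    m · 1#         ≈⟨ +-identityʳ (m · 1#) ⟨
    m · 1# + 0#    ≈⟨ +-congˡ -0#≈0# ⟨
    m · 1# - 0#    ∎
  ⊖-homo zero (suc n) = sym (+-identityˡ _)
  ⊖-homo (suc m) (suc n) = begin
    ⟦ suc m ⊖ suc n ⟧ℤ          ≡⟨ ≡.cong ⟦_⟧ℤ (ℤ.[1+m]⊖[1+n]≡m⊖n m n) ⟩
    ⟦ m ⊖ n ⟧ℤ                  ≈⟨ ⊖-homo m n ⟩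
    a - b                       ≈⟨ +-identityˡ (a - b) ⟨
    0# + (a - b)                ≈⟨ +-congʳ (-‿inverseʳ 1#) ⟨
    (1# - 1#) + (a - b)         ≈⟨ interchange 1# (- 1#) a (- b) ⟩
    (1# + a) + (- 1# - b)       ≈⟨ +-congˡ (⁻¹-∙-comm 1# b) ⟩
    (1# + a) - (1# + b)         ≈⟨ +-cong (suc-· m) (-‿cong (suc-· n)) ⟨
    suc m · 1# - suc n · 1#     ∎
    where a = m · 1#; b = n · 1#

  +-homo : ∀ i j → ⟦ i ℤ.+ j ⟧ℤ ≈ ⟦ i ⟧ℤ + ⟦ j ⟧ℤ
  +-homo (+ m) (+ n) = ×-homo-+ 1# m n
  +-homo (+ m) -[1+ n ] = ⊖-homo m (suc n)
  +-homo -[1+ m ] (+ n) = trans (⊖-homo n (suc m)) (+-comm _ _)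
  +-homo -[1+ m ] -[1+ n ] = begin
    - (suc (suc (m ℕ.+ n)) · 1#)       ≡⟨ ≡.cong (λ k → - (suc k · 1#)) (ℕ.+-suc m n) ⟨
    - ((suc m ℕ.+ suc n) · 1#)         ≈⟨ -‿cong (×-homo-+ 1# (suc m) (suc n)) ⟩
    - (suc m · 1# + suc n · 1#)        ≈⟨ ⁻¹-∙-comm _ _ ⟨
    - (suc m · 1#) + - (suc n · 1#)    ∎

  pos◃-homo : ∀ k → ⟦ Sign.+ ◃ k ⟧ℤ ≈ k · 1#
  pos◃-homo zero = refl
  pos◃-homo (suc k) = refl

  neg◃-homo : ∀ k → ⟦ Sign.- ◃ k ⟧ℤ ≈ - (k · 1#)
  neg◃-homo zero = sym -0#≈0#
  neg◃-homo (suc k) = refl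

  *-homo : ∀ i j → ⟦ i ℤ.* j ⟧ℤ ≈ ⟦ i ⟧ℤ * ⟦ j ⟧ℤ
  *-homo (+ m) (+ n) = trans (pos◃-homo (m ℕ.* n)) (×1-homo-* m n)
  *-homo (+ m) -[1+ n ] = begin
    ⟦ Sign.- ◃ (m ℕ.* suc n) ⟧ℤ      ≈⟨ neg◃-homo (m ℕ.* suc n) ⟩
    - ((m ℕ.* suc n) · 1#)           ≈⟨ -‿cong (×1-homo-* m (suc n)) ⟩
    - (m · 1# * suc n · 1#)          ≈⟨ -‿distribʳ-* _ _ ⟩
    m · 1# * - (suc n · 1#)          ∎
  *-homo -[1+ m ] (+ n) = begin
    ⟦ Sign.- ◃ (suc m ℕ.* n) ⟧ℤ      ≈⟨ neg◃-homo (suc m ℕ.* n) ⟩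
    - ((suc m ℕ.* n) · 1#)           ≈⟨ -‿cong (×1-homo-* (suc m) n) ⟩
    - (suc m · 1# * n · 1#)          ≈⟨ -‿distribˡ-* _ _ ⟩
    - (suc m · 1#) * n · 1#          ∎
  *-homo -[1+ m ] -[1+ n ] = begin
    ⟦ Sign.+ ◃ (suc m ℕ.* suc n) ⟧ℤ  ≈⟨ pos◃-homo (suc m ℕ.* suc n) ⟩
    (suc m ℕ.* suc n) · 1#           ≈⟨ ×1-homo-* (suc m) (suc n) ⟩
    a * b                            ≈⟨ -‿involutive (a * b) ⟨
    - - (a * b)                      ≈⟨ -‿cong (-‿distribˡ-* a b) ⟩
    - (- a * b)                      ≈⟨ -‿distribʳ-* (- a) b ⟩
    - a * - b                        ∎
    where a = suc m · 1#; b = suc n · 1#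

  -‿homo : ∀ i → ⟦ ℤ.- i ⟧ℤ ≈ - ⟦ i ⟧ℤ
  -‿homo (+ zero) = sym -0#≈0#
  -‿homo (+ suc n) = refl
  -‿homo -[1+ n ] = sym (-‿involutive _)

  ℤ⟶R : ℤ.+-*-rawRing -Raw-AlmostCommutative⟶ fromCommutativeRing R
  ℤ⟶R = record
    { ⟦_⟧ = ⟦_⟧ℤ ; +-homo = +-homo ; *-homo = *-homo ; -‿homo = -‿homo
    ; 0-homo = refl ; 1-homo = refl }

  ⟦⟧ℤ-≟ : ∀ i j → Maybe (⟦ i ⟧ℤ ≈ ⟦ j ⟧ℤ)
  ⟦⟧ℤ-≟ i j with i ℤ.≟ j
  ... | yes ≡.refl = just refl
  ... | no _ = nothing

  open import Algebra.Solver.Ring ℤ.+-*-rawRing (fromCommutativeRing R) ℤ⟶R ⟦⟧ℤ-≟ public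

module InscribedCornerInvariants (R : RealField) where
  open Geo R
  open ℤ-CoefficientSolver commRing using (solve; _:=_; _:+_; _:*_; _:-_; :-_; con; Polynomial)
  open import Algebra.Properties.Ring ring
    using (-‿involutive; -0#≈0#; x[y-z]≈xy-xz; [y-z]x≈yx-zx)
  open import Algebra.Properties.Group +-group using (x∙y⁻¹≈ε⇒x≈y; x≈y⇒x∙y⁻¹≈ε)
  open import Relation.Binary.Reasoning.Setoid setoid

  x≉0⇒x*y≈0⇒y≈0 : ∀ {x y} → x ≉ 0# → x * y ≈ 0# → y ≈ 0#
  x≉0⇒x*y≈0⇒y≈0 {x} {y} x≉0 xy≈0 = begin
    y                 ≈⟨ *-identityˡ y ⟨
    1# * y            ≈⟨ *-congʳ (⁻¹-inverse x x≉0) ⟨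
    (x * x ⁻¹) * y    ≈⟨ solve 3 (λ x x⁻¹ y → (x :* x⁻¹) :* y := x⁻¹ :* (x :* y)) refl x (x ⁻¹) y ⟩
    x ⁻¹ * (x * y)    ≈⟨ *-congˡ xy≈0 ⟩
    x ⁻¹ * 0#         ≈⟨ zeroʳ (x ⁻¹) ⟩
    0#                ∎

  x≉0∧y≉0⇒x*y≉0 : ∀ {x y} → x ≉ 0# → y ≉ 0# → x * y ≉ 0#
  x≉0∧y≉0⇒x*y≉0 x≉0 y≉0 = y≉0 ∘ x≉0⇒x*y≈0⇒y≈0 x≉0

  x*y≉0⇒x≉0 : ∀ {x y} → x * y ≉ 0# → x ≉ 0#
  x*y≉0⇒x≉0 {x} {y} xy≉0 x≈0 = xy≉0 (trans (*-congʳ x≈0) (zeroˡ y))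

  x*y≉0⇒y≉0 : ∀ {x y} → x * y ≉ 0# → y ≉ 0#
  x*y≉0⇒y≉0 {x} {y} xy≉0 y≈0 = xy≉0 (trans (*-congˡ y≈0) (zeroʳ x))

  x≈-y⇒y≉0⇒x≉0 : ∀ {x y} → x ≈ - y → y ≉ 0# → x ≉ 0#
  x≈-y⇒y≉0⇒x≉0 {x} {y} x≈-y y≉0 x≈0 = y≉0 (begin
    y        ≈⟨ -‿involutive y ⟨
    - - y    ≈⟨ -‿cong x≈-y ⟨
    - x      ≈⟨ -‿cong x≈0 ⟩
    - 0#     ≈⟨ -0#≈0# ⟩
    0#       ∎)

  ≉0-resp : ∀ {x y} → x ≈ y → x ≉ 0# → y ≉ 0#
  ≉0-resp x≈y x≉0 y≈0 = x≉0 (trans x≈y y≈0)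

  *-cancelˡ : ∀ {c x y} → c ≉ 0# → c * x ≈ c * y → x ≈ y
  *-cancelˡ {c} {x} {y} c≉0 cx≈cy =
    x∙y⁻¹≈ε⇒x≈y x y (x≉0⇒x*y≈0⇒y≈0 c≉0 (trans (x[y-z]≈xy-xz c x y) (x≈y⇒x∙y⁻¹≈ε cx≈cy)))

  /-*-cancel : ∀ {u w} → w ≉ 0# → u / w * w ≈ u
  /-*-cancel {u} {w} w≉0 = begin
    u * w ⁻¹ * w      ≈⟨ *-assoc u (w ⁻¹) w ⟩
    u * (w ⁻¹ * w)    ≈⟨ *-congˡ (*-comm (w ⁻¹) w) ⟩
    u * (w * w ⁻¹)    ≈⟨ *-congˡ (⁻¹-inverse w w≉0) ⟩
    u * 1#            ≈⟨ *-identityʳ u ⟩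
    u                 ∎

  *≈⇒≈/ : ∀ {x u w} → w ≉ 0# → x * w ≈ u → x ≈ u / w
  *≈⇒≈/ {x} {u} {w} w≉0 xw≈u = begin
    x                 ≈⟨ *-identityʳ x ⟨
    x * 1#            ≈⟨ *-congˡ (⁻¹-inverse w w≉0) ⟨
    x * (w * w ⁻¹)    ≈⟨ *-assoc x w (w ⁻¹) ⟨
    x * w * w ⁻¹      ≈⟨ *-congʳ xw≈u ⟩
    u * w ⁻¹          ∎

  /-cong-cross : ∀ {u w u′ w′} → w ≉ 0# → w′ ≉ 0# → u * w′ ≈ u′ * w → u / w ≈ u′ / w′
  /-cong-cross {u} {w} {u′} {w′} w≉0 w′≉0 uw′≈u′w = *≈⇒≈/ w′≉0 (*-cancelˡ w≉0 (begin
    w * (u / w * w′)   ≈⟨ solve 3 (λ w f w′ → w :* (f :* w′) := f :* w :* w′) refl w (u / w) w′ ⟩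
    u / w * w * w′     ≈⟨ *-congʳ (/-*-cancel w≉0) ⟩
    u * w′             ≈⟨ uw′≈u′w ⟩
    u′ * w             ≈⟨ *-comm u′ w ⟩
    w * u′             ∎))

  x≈y+z⇒x-y≈z : ∀ {x y z} → x ≈ y + z → x - y ≈ z
  x≈y+z⇒x-y≈z {x} {y} {z} x≈y+z = begin
    x - y              ≈⟨ +-congʳ x≈y+z ⟩
    y + z - y          ≈⟨ solve 2 (λ y z → y :+ z :- y := z) refl y z ⟩
    z                  ∎

  1-[1-x]≈x : ∀ x → 1# - (1# - x) ≈ x
  1-[1-x]≈x = solve 1 (λ x → con (+ 1) :- (con (+ 1) :- x) := x) refl

  module _ {n : ℕ} where
    V3′ : Set
    V3′ = Polynomial n × Polynomial n × Polynomial n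

    dot′ : V3′ → V3′ → Polynomial n
    dot′ (a₁ , a₂ , a₃) (b₁ , b₂ , b₃) = a₁ :* b₁ :+ a₂ :* b₂ :+ a₃ :* b₃

    cross′ : V3′ → V3′ → V3′
    cross′ (a₁ , a₂ , a₃) (b₁ , b₂ , b₃) =
      (a₂ :* b₃ :- a₃ :* b₂) , (a₃ :* b₁ :- a₁ :* b₃) , (a₁ :* b₂ :- a₂ :* b₁)

    det3′ : V3′ → V3′ → V3′ → Polynomial n
    det3′ a b c = dot′ a (cross′ b c)

  ≈v-refl : ∀ {a} → a ≈v a
  ≈v-refl = refl , refl , refl

  ≈v-sym : ∀ {a b} → a ≈v b → b ≈v a
  ≈v-sym (p₁ , p₂ , p₃) = sym p₁ , sym p₂ , sym p₃

  dot-cong : ∀ {a a′ b b′} → a ≈v a′ → b ≈v b′ → dot a b ≈ dot a′ b′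
  dot-cong (p₁ , p₂ , p₃) (q₁ , q₂ , q₃) = +-cong (+-cong (*-cong p₁ q₁) (*-cong p₂ q₂)) (*-cong p₃ q₃)

  cross-cong : ∀ {a a′ b b′} → a ≈v a′ → b ≈v b′ → cross a b ≈v cross a′ b′
  cross-cong (p₁ , p₂ , p₃) (q₁ , q₂ , q₃) =
    +-cong (*-cong p₂ q₃) (-‿cong (*-cong p₃ q₂)) ,
    +-cong (*-cong p₃ q₁) (-‿cong (*-cong p₁ q₃)) ,
    +-cong (*-cong p₁ q₂) (-‿cong (*-cong p₂ q₁))

  det3-cong : ∀ {a a′ b b′ c c′} → a ≈v a′ → b ≈v b′ → c ≈v c′ → det3 a b c ≈ det3 a′ b′ c′
  det3-cong p q r = dot-cong p (cross-cong q r)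

  det3-swap₂₃ : ∀ a b c → det3 a b c ≈ - det3 a c b
  det3-swap₂₃ (a₁ , a₂ , a₃) (b₁ , b₂ , b₃) (c₁ , c₂ , c₃) =
    solve 9 (λ a₁ a₂ a₃ b₁ b₂ b₃ c₁ c₂ c₃ →
      let a = a₁ , a₂ , a₃ ; b = b₁ , b₂ , b₃ ; c = c₁ , c₂ , c₃ in
      det3′ a b c := :- det3′ a c b)
      refl a₁ a₂ a₃ b₁ b₂ b₃ c₁ c₂ c₃

  det3-swap₂₃-≉0 : ∀ {a b c} → det3 a b c ≉ 0# → det3 a c b ≉ 0#
  det3-swap₂₃-≉0 {a} {b} {c} = x≈-y⇒y≉0⇒x≉0 (det3-swap₂₃ a c b)

  dot-cross-selfˡ : ∀ a b → dot a (cross a b) ≈ 0#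
  dot-cross-selfˡ (a₁ , a₂ , a₃) (b₁ , b₂ , b₃) =
    solve 6 (λ a₁ a₂ a₃ b₁ b₂ b₃ →
      let a = a₁ , a₂ , a₃ ; b = b₁ , b₂ , b₃ in
      dot′ a (cross′ a b) := con (+ 0))
      refl a₁ a₂ a₃ b₁ b₂ b₃

  dot-cross-selfʳ : ∀ a b → dot b (cross a b) ≈ 0#
  dot-cross-selfʳ (a₁ , a₂ , a₃) (b₁ , b₂ , b₃) =
    solve 6 (λ a₁ a₂ a₃ b₁ b₂ b₃ →
      let a = a₁ , a₂ , a₃ ; b = b₁ , b₂ , b₃ in
      dot′ b (cross′ a b) := con (+ 0))
      refl a₁ a₂ a₃ b₁ b₂ b₃

  binet-cauchy : ∀ a b c d → dot (cross a b) (cross c d) ≈ dot a c * dot b d - dot a d * dot b c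
  binet-cauchy (a₁ , a₂ , a₃) (b₁ , b₂ , b₃) (c₁ , c₂ , c₃) (d₁ , d₂ , d₃) =
    solve 12 (λ a₁ a₂ a₃ b₁ b₂ b₃ c₁ c₂ c₃ d₁ d₂ d₃ →
      let a = a₁ , a₂ , a₃ ; b = b₁ , b₂ , b₃ ; c = c₁ , c₂ , c₃ ; d = d₁ , d₂ , d₃ in
      dot′ (cross′ a b) (cross′ c d) := dot′ a c :* dot′ b d :- dot′ a d :* dot′ b c)
      refl a₁ a₂ a₃ b₁ b₂ b₃ c₁ c₂ c₃ d₁ d₂ d₃

  det3-cross-cross : ∀ L x y → det3 L (cross L x) (cross L y) ≈ dot L L * det3 L x y
  det3-cross-cross (l₁ , l₂ , l₃) (x₁ , x₂ , x₃) (y₁ , y₂ , y₃) =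
    solve 9 (λ l₁ l₂ l₃ x₁ x₂ x₃ y₁ y₂ y₃ →
      let L = l₁ , l₂ , l₃ ; x = x₁ , x₂ , x₃ ; y = y₁ , y₂ , y₃ in
      det3′ L (cross′ L x) (cross′ L y) := dot′ L L :* det3′ L x y)
      refl l₁ l₂ l₃ x₁ x₂ x₃ y₁ y₂ y₃

  det3-cross : ∀ L a x → det3 L a (cross L x) ≈ dot L L * dot a x - dot L x * dot a L
  det3-cross (l₁ , l₂ , l₃) (a₁ , a₂ , a₃) (x₁ , x₂ , x₃) =
    solve 9 (λ l₁ l₂ l₃ a₁ a₂ a₃ x₁ x₂ x₃ →
      let L = l₁ , l₂ , l₃ ; a = a₁ , a₂ , a₃ ; x = x₁ , x₂ , x₃ in
      det3′ L a (cross′ L x) := dot′ L L :* dot′ a x :- dot′ L x :* dot′ a L)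
      refl l₁ l₂ l₃ a₁ a₂ a₃ x₁ x₂ x₃

  det3-cross-incident : ∀ {L p} x → dot p L ≈ 0# → det3 L p (cross L x) ≈ dot L L * dot p x
  det3-cross-incident {L} {p} x pL≈0 = begin
    det3 L p (cross L x)                  ≈⟨ det3-cross L p x ⟩
    dot L L * dot p x - dot L x * dot p L ≈⟨ +-congˡ (-‿cong (*-congˡ pL≈0)) ⟩
    dot L L * dot p x - dot L x * 0#      ≈⟨ solve 2 (λ u v → u :- v :* con (+ 0) := u) refl (dot L L * dot p x) (dot L x) ⟩
    dot L L * dot p x                     ∎

  plücker : ∀ o x y z w →
    det3 o x z * det3 o y w ≈ det3 o x y * det3 o z w + det3 o x w * det3 o y z
  plücker (o₁ , o₂ , o₃) (x₁ , x₂ , x₃) (y₁ , y₂ , y₃) (z₁ , z₂ , z₃) (w₁ , w₂ , w₃) =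
    solve 15 (λ o₁ o₂ o₃ x₁ x₂ x₃ y₁ y₂ y₃ z₁ z₂ z₃ w₁ w₂ w₃ →
      let o = o₁ , o₂ , o₃ ; x = x₁ , x₂ , x₃ ; y = y₁ , y₂ , y₃ ; z = z₁ , z₂ , z₃ ; w = w₁ , w₂ , w₃ in
      det3′ o x z :* det3′ o y w := det3′ o x y :* det3′ o z w :+ det3′ o x w :* det3′ o y z)
      refl o₁ o₂ o₃ x₁ x₂ x₃ y₁ y₂ y₃ z₁ z₂ z₃ w₁ w₂ w₃

  det3-dots : ∀ a b c u v w →
    det3 (dot a u , dot a v , dot a w) (dot b u , dot b v , dot b w) (dot c u , dot c v , dot c w)
      ≈ det3 a b c * det3 u v w
  det3-dots (a₁ , a₂ , a₃) (b₁ , b₂ , b₃) (c₁ , c₂ , c₃) (u₁ , u₂ , u₃) (v₁ , v₂ , v₃) (w₁ , w₂ , w₃) =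
    solve 18 (λ a₁ a₂ a₃ b₁ b₂ b₃ c₁ c₂ c₃ u₁ u₂ u₃ v₁ v₂ v₃ w₁ w₂ w₃ →
      let a = a₁ , a₂ , a₃ ; b = b₁ , b₂ , b₃ ; c = c₁ , c₂ , c₃
          u = u₁ , u₂ , u₃ ; v = v₁ , v₂ , v₃ ; w = w₁ , w₂ , w₃ in
      det3′ (dot′ a u , dot′ a v , dot′ a w) (dot′ b u , dot′ b v , dot′ b w) (dot′ c u , dot′ c v , dot′ c w)
        := det3′ a b c :* det3′ u v w)
      refl a₁ a₂ a₃ b₁ b₂ b₃ c₁ c₂ c₃ u₁ u₂ u₃ v₁ v₂ v₃ w₁ w₂ w₃

  det3-apply : ∀ M a b c → det3 (apply M a) (apply M b) (apply M c) ≈ detM M * det3 a b c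
  det3-apply ((m₁ , m₂ , m₃) , (m₄ , m₅ , m₆) , (m₇ , m₈ , m₉)) (a₁ , a₂ , a₃) (b₁ , b₂ , b₃) (c₁ , c₂ , c₃) =
    solve 18 (λ m₁ m₂ m₃ m₄ m₅ m₆ m₇ m₈ m₉ a₁ a₂ a₃ b₁ b₂ b₃ c₁ c₂ c₃ →
      let r₁ = m₁ , m₂ , m₃ ; r₂ = m₄ , m₅ , m₆ ; r₃ = m₇ , m₈ , m₉
          a = a₁ , a₂ , a₃ ; b = b₁ , b₂ , b₃ ; c = c₁ , c₂ , c₃ in
      det3′ (dot′ r₁ a , dot′ r₂ a , dot′ r₃ a) (dot′ r₁ b , dot′ r₂ b , dot′ r₃ b) (dot′ r₁ c , dot′ r₂ c , dot′ r₃ c)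
        := det3′ r₁ r₂ r₃ :* det3′ a b c)
      refl m₁ m₂ m₃ m₄ m₅ m₆ m₇ m₈ m₉ a₁ a₂ a₃ b₁ b₂ b₃ c₁ c₂ c₃

  -- xInv v i is corner (v (i - 2)) ... (v (i + 2)); yInv v i is the same with the five points reversed.
  corner : V3 → V3 → V3 → V3 → V3 → Carrier
  corner a b c d e = let L = line a b in crLine L a b (meet L (line c d)) (meet L (line d e))

  cornerDen : V3 → V3 → V3 → V3 → V3 → Carrier
  cornerDen a b c d e = let L = line a b in crLineDen L a b (meet L (line c d)) (meet L (line d e))

  cornerDen≈ : ∀ a b c d e → let N = dot (cross a b) (cross a b) in
    cornerDen a b c d e ≈ N * det3 a c d * (N * det3 b d e)
  cornerDen≈ a b c d e = *-cong (det3-cross-incident (cross c d) (dot-cross-selfˡ a b))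
                                (det3-cross-incident (cross d e) (dot-cross-selfʳ a b))

  cornerDen≉0⇒acd*bde≉0 : ∀ a b c d e → cornerDen a b c d e ≉ 0# → det3 a c d * det3 b d e ≉ 0#
  cornerDen≉0⇒acd*bde≉0 a b c d e den≉0 =
    x≉0∧y≉0⇒x*y≉0 (x*y≉0⇒y≉0 (x*y≉0⇒x≉0 Nacd*Nbde≉0)) (x*y≉0⇒y≉0 (x*y≉0⇒y≉0 Nacd*Nbde≉0))
    where Nacd*Nbde≉0 = ≉0-resp (cornerDen≈ a b c d e) den≉0

  corner≈ : ∀ a b c d e → cornerDen a b c d e ≉ 0# →
    corner a b c d e ≈ (det3 a c d * det3 b d e - det3 a d e * det3 b c d) / (det3 a c d * det3 b d e)
  corner≈ a b c d e den≉0 = /-cong-cross den≉0 (cornerDen≉0⇒acd*bde≉0 a b c d e den≉0) (begin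
    N * det3 L (cross L (cross c d)) (cross L (cross d e)) * (acd * bde)
      ≈⟨ *-congʳ (*-congˡ (det3-cross-cross L (cross c d) (cross d e))) ⟩
    N * (N * det3 L (cross c d) (cross d e)) * (acd * bde)
      ≈⟨ *-congʳ (*-congˡ (*-congˡ (binet-cauchy a b (cross c d) (cross d e)))) ⟩
    N * (N * K) * (acd * bde)
      ≈⟨ solve 4 (λ N K u v → N :* (N :* K) :* (u :* v) := K :* (N :* u :* (N :* v))) refl N K acd bde ⟩
    K * (N * acd * (N * bde))
      ≈⟨ *-congˡ (cornerDen≈ a b c d e) ⟨
    K * cornerDen a b c d e ∎)
    where
    L = cross a b
    N = dot L L
    acd = det3 a c d
    bde = det3 b d e
    K = acd * bde - det3 a d e * det3 b c d

  one-minus-crConic : ∀ O p q r s → crConicDen O p q r s ≉ 0# →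
    (1# - crConic O p q r s) * crConicDen O p q r s ≈ det3 O p s * det3 O q r
  one-minus-crConic O p q r s D≉0 = begin
    (1# - crConic O p q r s) * D               ≈⟨ [y-z]x≈yx-zx D 1# (crConic O p q r s) ⟩
    1# * D - crConic O p q r s * D             ≈⟨ +-cong (*-identityˡ D) (-‿cong (/-*-cancel D≉0)) ⟩
    D - det3 O p q * det3 O r s                ≈⟨ x≈y+z⇒x-y≈z (plücker O p q r s) ⟩
    det3 O p s * det3 O q r                    ∎
    where D = crConicDen O p q r s

  crConic-cocycle : ∀ O {a b c d e} → det3 O a c ≉ 0# → det3 O b d ≉ 0# → det3 O b e ≉ 0# → det3 O c e ≉ 0# →
    crConic O a b c e * (1# - crConic O b c d e) ≈ crConic O a b c d
  crConic-cocycle O {a} {b} {c} {d} {e} Oac≉0 Obd≉0 Obe≉0 Oce≉0 =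
    *≈⇒≈/ (x≉0∧y≉0⇒x*y≉0 Oac≉0 Obd≉0) (*-cancelˡ (x≉0∧y≉0⇒x*y≉0 Obe≉0 Oce≉0) (begin
      Obe * Oce * (h * (1# - g) * (Oac * Obd))
        ≈⟨ solve 6 (λ Obe Oce h g′ Oac Obd → Obe :* Oce :* (h :* g′ :* (Oac :* Obd))
                                           := h :* (Oac :* Obe) :* (g′ :* (Obd :* Oce)))
                   refl Obe Oce h (1# - g) Oac Obd ⟩
      h * (Oac * Obe) * ((1# - g) * (Obd * Oce))
        ≈⟨ *-cong (/-*-cancel (x≉0∧y≉0⇒x*y≉0 Oac≉0 Obe≉0))
                  (one-minus-crConic O b c d e (x≉0∧y≉0⇒x*y≉0 Obd≉0 Oce≉0)) ⟩
      det3 O a b * Oce * (Obe * det3 O c d)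
        ≈⟨ solve 4 (λ Oab Oce Obe Ocd → Oab :* Oce :* (Obe :* Ocd) := Obe :* Oce :* (Oab :* Ocd))
                   refl (det3 O a b) Oce Obe (det3 O c d) ⟩
      Obe * Oce * (det3 O a b * det3 O c d) ∎))
    where
    Oac = det3 O a c
    Obd = det3 O b d
    Obe = det3 O b e
    Oce = det3 O c e
    h = crConic O a b c e
    g = crConic O b c d e

  det3-swap₂₃² : ∀ o x y z w → det3 o y x * det3 o w z ≈ det3 o x y * det3 o z w
  det3-swap₂₃² (o₁ , o₂ , o₃) (x₁ , x₂ , x₃) (y₁ , y₂ , y₃) (z₁ , z₂ , z₃) (w₁ , w₂ , w₃) =
    solve 15 (λ o₁ o₂ o₃ x₁ x₂ x₃ y₁ y₂ y₃ z₁ z₂ z₃ w₁ w₂ w₃ →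
      let o = o₁ , o₂ , o₃ ; x = x₁ , x₂ , x₃ ; y = y₁ , y₂ , y₃ ; z = z₁ , z₂ , z₃ ; w = w₁ , w₂ , w₃ in
      det3′ o y x :* det3′ o w z := det3′ o x y :* det3′ o z w)
      refl o₁ o₂ o₃ x₁ x₂ x₃ y₁ y₂ y₃ z₁ z₂ z₃ w₁ w₂ w₃

  -- _⁻¹ is only known to respect ≈ at nonzero arguments, hence the hypothesis.
  crConic-reverse : ∀ O p q r s → crConicDen O p q r s ≉ 0# → crConic O s r q p ≈ crConic O p q r s
  crConic-reverse O p q r s D≉0 = /-cong-cross (≉0-resp (sym den≈) D≉0) D≉0 (*-cong num≈ (sym den≈))
    where
    num≈ : det3 O s r * det3 O q p ≈ det3 O p q * det3 O r s
    num≈ = trans (det3-swap₂₃² O r s p q) (*-comm _ _)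
    den≈ : det3 O s q * det3 O r p ≈ det3 O p r * det3 O q s
    den≈ = trans (det3-swap₂₃² O q s p r) (*-comm _ _)

  crConic-cocycle′ : ∀ O {a b c d e} → det3 O a c ≉ 0# → det3 O b d ≉ 0# → det3 O a d ≉ 0# → det3 O c e ≉ 0# →
    crConic O a c d e * (1# - crConic O a b c d) ≈ crConic O b c d e
  crConic-cocycle′ O {a} {b} {c} {d} {e} Oac≉0 Obd≉0 Oad≉0 Oce≉0 = begin
    crConic O a c d e * (1# - crConic O a b c d)
      ≈⟨ *-cong (crConic-reverse O a c d e (x≉0∧y≉0⇒x*y≉0 Oad≉0 Oce≉0))
                (+-congˡ (-‿cong (crConic-reverse O a b c d (x≉0∧y≉0⇒x*y≉0 Oac≉0 Obd≉0)))) ⟨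
    crConic O e d c a * (1# - crConic O d c b a)
      ≈⟨ crConic-cocycle O (det3-swap₂₃-≉0 Oce≉0) (det3-swap₂₃-≉0 Obd≉0)
                           (det3-swap₂₃-≉0 Oad≉0) (det3-swap₂₃-≉0 Oac≉0) ⟩
    crConic O e d c b
      ≈⟨ crConic-reverse O b c d e (x≉0∧y≉0⇒x*y≉0 Obd≉0 Oce≉0) ⟩
    crConic O b c d e ∎

  crConic-cong≡ : ∀ O {p p′ q q′ r r′ s s′} → p ≡ p′ → q ≡ q′ → r ≡ r′ → s ≡ s′ →
    crConic O p q r s ≡ crConic O p′ q′ r′ s′
  crConic-cong≡ O ≡.refl ≡.refl ≡.refl ≡.refl = ≡.refl

  pInv-suc : ∀ O v i → pInv O v (i ℤ.+ ℤ.+ 1) ≡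
    1# - crConic O (v (i ℤ.+ (ℤ.- ℤ.+ 1))) (v (i ℤ.+ ℤ.+ 0)) (v (i ℤ.+ ℤ.+ 1)) (v (i ℤ.+ ℤ.+ 2))
  pInv-suc O v i = ≡.cong (λ t → 1# - t) (crConic-cong≡ O (shift _) (shift _) (shift _) (shift _))
    where
    shift : ∀ k → v (i ℤ.+ ℤ.+ 1 ℤ.+ k) ≡ v (i ℤ.+ (ℤ.+ 1 ℤ.+ k))
    shift k = ≡.cong v (ℤ.+-assoc i (ℤ.+ 1) k)

  polar : Mat3 → V3 → V3 → Carrier
  polar Q u w = dot u (apply Q w)

  gram-row : Mat3 → V3 → V3 → V3 → V3 → V3
  gram-row Q p r₁ r₂ r₃ = polar Q p r₁ , polar Q p r₂ , polar Q p r₃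

  det3-gram : ∀ Q p₁ p₂ p₃ r₁ r₂ r₃ →
    det3 (gram-row Q p₁ r₁ r₂ r₃) (gram-row Q p₂ r₁ r₂ r₃) (gram-row Q p₃ r₁ r₂ r₃)
      ≈ det3 p₁ p₂ p₃ * (detM Q * det3 r₁ r₂ r₃)
  det3-gram Q p₁ p₂ p₃ r₁ r₂ r₃ =
    trans (det3-dots p₁ p₂ p₃ (apply Q r₁) (apply Q r₂) (apply Q r₃)) (*-congˡ (det3-apply Q r₁ r₂ r₃))

  polar-transpose : ∀ Q u w → polar Q u w ≈ polar (transpose Q) w u
  polar-transpose ((q₁ , q₂ , q₃) , (q₄ , q₅ , q₆) , (q₇ , q₈ , q₉)) (u₁ , u₂ , u₃) (w₁ , w₂ , w₃) =
    solve 15 (λ q₁ q₂ q₃ q₄ q₅ q₆ q₇ q₈ q₉ u₁ u₂ u₃ w₁ w₂ w₃ →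
      let u = u₁ , u₂ , u₃ ; w = w₁ , w₂ , w₃ in
      dot′ u (dot′ (q₁ , q₂ , q₃) w , dot′ (q₄ , q₅ , q₆) w , dot′ (q₇ , q₈ , q₉) w)
        := dot′ w (dot′ (q₁ , q₄ , q₇) u , dot′ (q₂ , q₅ , q₈) u , dot′ (q₃ , q₆ , q₉) u))
      refl q₁ q₂ q₃ q₄ q₅ q₆ q₇ q₈ q₉ u₁ u₂ u₃ w₁ w₂ w₃

  polar-sym : ∀ {Q} → Q ≈m transpose Q → ∀ u w → polar Q u w ≈ polar Q w u
  polar-sym (r₁ , r₂ , r₃) u w = trans (polar-transpose _ u w)
    (dot-cong ≈v-refl (dot-cong (≈v-sym r₁) ≈v-refl , dot-cong (≈v-sym r₂) ≈v-refl , dot-cong (≈v-sym r₃) ≈v-refl))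

  module OnNondegenerateConic (Q : Mat3) (Q-sym : Q ≈m transpose Q) (detQ≉0 : detM Q ≉ 0#)
                              (O : V3) (O∈C : OnConic Q O) where

    -- Times detM Q, both sides are Gram determinants of the polar form (det3-gram); on points of C the
    -- diagonal entries vanish, and the two determinants expand to Byz * T and Ox * T for the same T.
    det3-on-conic : ∀ {x y z} → OnConic Q x → OnConic Q y → OnConic Q z →
      det3 y x z * (det3 O y z * polar Q O x) ≈ det3 O y x * (det3 O x z * polar Q y z)
    det3-on-conic {x} {y} {z} x∈C y∈C z∈C = *-cancelˡ detQ≉0 (begin
      Δ * (yxz * (Oyz * Ox))    ≈⟨ solve 4 (λ Δ a b c → Δ :* (a :* (b :* c)) := a :* (Δ :* b) :* c) refl Δ yxz Oyz Ox ⟩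
      yxz * (Δ * Oyz) * Ox      ≈⟨ *-congʳ gram₁ ⟩
      Byz * T * Ox              ≈⟨ solve 3 (λ a t b → a :* t :* b := b :* t :* a) refl Byz T Ox ⟩
      Ox * T * Byz              ≈⟨ *-congʳ gram₂ ⟨
      Oyx * (Δ * Oxz) * Byz     ≈⟨ solve 4 (λ Δ a b c → a :* (Δ :* b) :* c := Δ :* (a :* (b :* c))) refl Δ Oyx Oxz Byz ⟩
      Δ * (Oyx * (Oxz * Byz))   ∎)
      where
      Δ = detM Q
      yxz = det3 y x z
      Oyz = det3 O y z
      Oyx = det3 O y x
      Oxz = det3 O x z
      Ox = polar Q O x
      Oy = polar Q O y
      Oz = polar Q O z
      Bxy = polar Q x y
      Bxz = polar Q x z
      Byz = polar Q y z
      T = Ox * Byz - Bxy * Oz - Bxz * Oy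
      gram₁ : yxz * (Δ * Oyz) ≈ Byz * T
      gram₁ = begin
        yxz * (Δ * Oyz)
          ≈⟨ det3-gram Q y x z O y z ⟨
        det3 (gram-row Q y O y z) (gram-row Q x O y z) (gram-row Q z O y z)
          ≈⟨ det3-cong (polar-sym Q-sym y O , y∈C , refl)
                       (polar-sym Q-sym x O , refl , refl)
                       (polar-sym Q-sym z O , polar-sym Q-sym z y , z∈C) ⟩
        det3 (Oy , 0# , Byz) (Ox , Bxy , Bxz) (Oz , Byz , 0#)
          ≈⟨ solve 6 (λ a b c d e f →
               det3′ (a , con (+ 0) , f) (b , c , d) (e , f , con (+ 0)) := f :* (b :* f :- c :* e :- d :* a))
               refl Oy Ox Bxy Bxz Oz Byz ⟩
        Byz * T ∎
      gram₂ : Oyx * (Δ * Oxz) ≈ Ox * T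
      gram₂ = begin
        Oyx * (Δ * Oxz)
          ≈⟨ det3-gram Q O y x O x z ⟨
        det3 (gram-row Q O O x z) (gram-row Q y O x z) (gram-row Q x O x z)
          ≈⟨ det3-cong (O∈C , refl , refl)
                       (polar-sym Q-sym y O , polar-sym Q-sym y x , refl)
                       (polar-sym Q-sym x O , x∈C , refl) ⟩
        det3 (0# , Ox , Oz) (Oy , Bxy , Byz) (Ox , 0# , Bxz)
          ≈⟨ solve 6 (λ g h a c f d →
               det3′ (con (+ 0) , g , h) (a , c , f) (g , con (+ 0) , d) := g :* (g :* f :- c :* h :- d :* a))
               refl Ox Oz Oy Bxy Byz Bxz ⟩
        Ox * T ∎

    -- Otherwise the Gram matrix of (O, x, y) would have two rows of the form (0, 0, _).
    polar-≉0 : ∀ {x y} → OnConic Q x → det3 O x y ≉ 0# → polar Q O x ≉ 0#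
    polar-≉0 {x} {y} x∈C Oxy≉0 Ox≈0 =
      x≉0∧y≉0⇒x*y≉0 Oxy≉0 (x≉0∧y≉0⇒x*y≉0 detQ≉0 Oxy≉0) (begin
        det3 O x y * (detM Q * det3 O x y)
          ≈⟨ det3-gram Q O x y O x y ⟨
        det3 (gram-row Q O O x y) (gram-row Q x O x y) (gram-row Q y O x y)
          ≈⟨ det3-cong (O∈C , Ox≈0 , refl) (trans (polar-sym Q-sym x O) Ox≈0 , x∈C , refl) ≈v-refl ⟩
        det3 (0# , 0# , polar Q O y) (0# , 0# , polar Q x y) (gram-row Q y O x y)
          ≈⟨ solve 5 (λ a b r₁ r₂ r₃ →
               det3′ (con (+ 0) , con (+ 0) , a) (con (+ 0) , con (+ 0) , b) (r₁ , r₂ , r₃) := con (+ 0))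
               refl (polar Q O y) (polar Q x y) (polar Q y O) (polar Q y x) (polar Q y y) ⟩
        0# ∎)

    steiner : ∀ {a b c e P} → OnConic Q a → OnConic Q b → OnConic Q c → OnConic Q e → OnConic Q P →
      det3 O a P ≉ 0# → det3 O b P ≉ 0# → polar Q O c ≉ 0# → polar Q O e ≉ 0# →
      det3 a e P * det3 b c P * (det3 O a c * det3 O b e) ≈ det3 a c P * det3 b e P * (det3 O a e * det3 O b c)
    steiner {a} {b} {c} {e} {P} a∈C b∈C c∈C e∈C P∈C OaP≉0 ObP≉0 Oc≉0 Oe≉0 =
      *-cancelˡ (x≉0∧y≉0⇒x*y≉0 (x≉0∧y≉0⇒x*y≉0 OaP≉0 Oe≉0) (x≉0∧y≉0⇒x*y≉0 ObP≉0 Oc≉0)) (begin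
        OaP * Oe * (ObP * Oc) * (aeP * bcP * (Oac * Obe))
          ≈⟨ solve 8 (λ OaP Oe ObP Oc aeP bcP Oac Obe →
                 OaP :* Oe :* (ObP :* Oc) :* (aeP :* bcP :* (Oac :* Obe))
                   := aeP :* (OaP :* Oe) :* (bcP :* (ObP :* Oc)) :* (Oac :* Obe))
               refl OaP Oe ObP Oc aeP bcP Oac Obe ⟩
        aeP * (OaP * Oe) * (bcP * (ObP * Oc)) * (Oac * Obe)
          ≈⟨ *-congʳ (*-cong (det3-on-conic e∈C a∈C P∈C) (det3-on-conic c∈C b∈C P∈C)) ⟩
        Oae * (OeP * BaP) * (Obc * (OcP * BbP)) * (Oac * Obe)
          ≈⟨ solve 8 (λ Oae OeP BaP Obc OcP BbP Oac Obe →
                 Oae :* (OeP :* BaP) :* (Obc :* (OcP :* BbP)) :* (Oac :* Obe)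
                   := Oac :* (OcP :* BaP) :* (Obe :* (OeP :* BbP)) :* (Oae :* Obc))
               refl Oae OeP BaP Obc OcP BbP Oac Obe ⟩
        Oac * (OcP * BaP) * (Obe * (OeP * BbP)) * (Oae * Obc)
          ≈⟨ *-congʳ (*-cong (det3-on-conic c∈C a∈C P∈C) (det3-on-conic e∈C b∈C P∈C)) ⟨
        acP * (OaP * Oc) * (beP * (ObP * Oe)) * (Oae * Obc)
          ≈⟨ solve 8 (λ OaP Oe ObP Oc acP beP Oae Obc →
                 acP :* (OaP :* Oc) :* (beP :* (ObP :* Oe)) :* (Oae :* Obc)
                   := OaP :* Oe :* (ObP :* Oc) :* (acP :* beP :* (Oae :* Obc)))
               refl OaP Oe ObP Oc acP beP Oae Obc ⟩
        OaP * Oe * (ObP * Oc) * (acP * beP * (Oae * Obc)) ∎)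
      where
      OaP = det3 O a P
      ObP = det3 O b P
      OcP = det3 O c P
      OeP = det3 O e P
      Oac = det3 O a c
      Oae = det3 O a e
      Obc = det3 O b c
      Obe = det3 O b e
      aeP = det3 a e P
      bcP = det3 b c P
      acP = det3 a c P
      beP = det3 b e P
      Oc = polar Q O c
      Oe = polar Q O e
      BaP = polar Q a P
      BbP = polar Q b P

    corner-on-conic : ∀ {a b c d e} → OnConic Q a → OnConic Q b → OnConic Q c → OnConic Q d → OnConic Q e →
      det3 O a c ≉ 0# → det3 O b d ≉ 0# → det3 O c e ≉ 0# → det3 O a d ≉ 0# → det3 O b e ≉ 0# →
      cornerDen a b c d e ≉ 0# → corner a b c d e ≈ crConic O a b c e
    corner-on-conic {a} {b} {c} {d} {e} a∈C b∈C c∈C d∈C e∈C Oac≉0 Obd≉0 Oce≉0 Oad≉0 Obe≉0 den≉0 =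
      trans (corner≈ a b c d e den≉0)
            (/-cong-cross (cornerDen≉0⇒acd*bde≉0 a b c d e den≉0) (x≉0∧y≉0⇒x*y≉0 Oac≉0 Obe≉0) (begin
        (acd * bde - ade * bcd) * (Oac * Obe)            ≈⟨ [y-z]x≈yx-zx (Oac * Obe) (acd * bde) (ade * bcd) ⟩
        acd * bde * (Oac * Obe) - ade * bcd * (Oac * Obe) ≈⟨ +-congˡ (-‿cong steiner-at-d) ⟩
        acd * bde * (Oac * Obe) - acd * bde * (Oae * Obc) ≈⟨ x[y-z]≈xy-xz (acd * bde) (Oac * Obe) (Oae * Obc) ⟨
        acd * bde * (Oac * Obe - Oae * Obc)              ≈⟨ *-congˡ (x≈y+z⇒x-y≈z (trans (plücker O a b c e) (+-comm _ _))) ⟩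
        acd * bde * (det3 O a b * det3 O c e)            ≈⟨ *-comm (acd * bde) _ ⟩
        det3 O a b * det3 O c e * (acd * bde)            ∎))
      where
      acd = det3 a c d
      bde = det3 b d e
      ade = det3 a d e
      bcd = det3 b c d
      Oac = det3 O a c
      Obe = det3 O b e
      Oae = det3 O a e
      Obc = det3 O b c
      steiner-at-d : ade * bcd * (Oac * Obe) ≈ acd * bde * (Oae * Obc)
      steiner-at-d = begin
        ade * bcd * (Oac * Obe)                   ≈⟨ solve 3 (λ x y z → x :* y :* z := :- (:- x :* y :* z)) refl ade bcd (Oac * Obe) ⟩
        - (- ade * bcd * (Oac * Obe))             ≈⟨ -‿cong (*-congʳ (*-congʳ (det3-swap₂₃ a e d))) ⟨
        - (det3 a e d * bcd * (Oac * Obe))        ≈⟨ -‿cong (steiner a∈C b∈C c∈C e∈C d∈C Oad≉0 Obd≉0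
                                                       (polar-≉0 c∈C Oce≉0) (polar-≉0 e∈C (det3-swap₂₃-≉0 Oce≉0))) ⟩
        - (acd * det3 b e d * (Oae * Obc))        ≈⟨ -‿cong (*-congʳ (*-congˡ (det3-swap₂₃ b e d))) ⟩
        - (acd * - bde * (Oae * Obc))             ≈⟨ solve 3 (λ x y z → :- (x :* :- y :* z) := x :* y :* z) refl acd bde (Oae * Obc) ⟩
        acd * bde * (Oae * Obc)                   ∎

    inscribed-corner : ∀ {a b c d e} → OnConic Q a → OnConic Q b → OnConic Q c → OnConic Q d → OnConic Q e →
      crConicDen O a b c d ≉ 0# → crConicDen O a b c e ≉ 0# → crConicDen O a c d e ≉ 0# →
      cornerDen a b c d e ≉ 0# → cornerDen e d c b a ≉ 0# →
      1# - crConic O a b c d ≉ 0# → 1# - crConic O b c d e ≉ 0# →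
      (corner a b c d e ≈ crConic O a b c e) × (corner e d c b a ≈ crConic O a c d e) ×
      (corner a b c d e ≈ (1# - (1# - crConic O a b c d)) / (1# - crConic O b c d e)) ×
      (corner e d c b a ≈ (1# - (1# - crConic O b c d e)) / (1# - crConic O a b c d))
    inscribed-corner {a} {b} {c} {d} {e} a∈C b∈C c∈C d∈C e∈C A≉0 B≉0 C≉0 x≉0 y≉0 p≉0 p₊≉0 =
      x≈crB , y≈crC ,
      *≈⇒≈/ p₊≉0 (trans (*-congʳ x≈crB) (trans (crConic-cocycle O Oac≉0 Obd≉0 Obe≉0 Oce≉0) (sym (1-[1-x]≈x _)))) ,
      *≈⇒≈/ p≉0 (trans (*-congʳ y≈crC) (trans (crConic-cocycle′ O Oac≉0 Obd≉0 Oad≉0 Oce≉0) (sym (1-[1-x]≈x _))))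
      where
      Oac≉0 = x*y≉0⇒x≉0 A≉0
      Obd≉0 = x*y≉0⇒y≉0 A≉0
      Obe≉0 = x*y≉0⇒y≉0 B≉0
      Oad≉0 = x*y≉0⇒x≉0 C≉0
      Oce≉0 = x*y≉0⇒y≉0 C≉0
      x≈crB = corner-on-conic a∈C b∈C c∈C d∈C e∈C Oac≉0 Obd≉0 Oce≉0 Oad≉0 Obe≉0 x≉0
      y≈crC = trans (corner-on-conic e∈C d∈C c∈C b∈C a∈C (det3-swap₂₃-≉0 Oce≉0) (det3-swap₂₃-≉0 Obd≉0)
                       (det3-swap₂₃-≉0 Oac≉0) (det3-swap₂₃-≉0 Obe≉0) (det3-swap₂₃-≉0 Oad≉0) y≉0)
                    (crConic-reverse O a c d e C≉0)

lemma3p1 : (R : RealField) → let open Geo R in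
    (n : ℕ) (v : ℤ → V3) (M : Mat3) (Q : Mat3) (O : V3) →
    IsTwistedNGon n v M →
    IsNondegConic Q → (∀ i → OnConic Q (v i)) →
    ¬ (O ≈v 𝟎) → OnConic Q O → (∀ i → ¬ SamePoint O (v i)) →
    AllDefined O v →
    ∀ i →
    (xInv v i ≈ crB O v i) × (yInv v i ≈ crC O v i) ×
    (xInv v i ≈ (1# - pInv O v i) / pInv O v (i ℤ.+ ℤ.+ 1)) ×
    (yInv v i ≈ (1# - pInv O v (i ℤ.+ ℤ.+ 1)) / pInv O v i)
lemma3p1 R _ v _ Q O _ (Q-sym , detQ≉0) v∈C _ O∈C _ defined i
  with defined i | defined (i ℤ.+ ℤ.+ 1)
... | x≉0 , y≉0 , A≉0 , B≉0 , C≉0 , p≉0 | _ , _ , _ , _ , _ , p₊≉0 =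
  ≡.subst (λ p₊ → (xInv v i ≈ crB O v i) × (yInv v i ≈ crC O v i) ×
                  (xInv v i ≈ (1# - pInv O v i) / p₊) × (yInv v i ≈ (1# - p₊) / pInv O v i))
          (≡.sym (pInv-suc O v i))
          (inscribed-corner (v∈C _) (v∈C _) (v∈C _) (v∈C _) (v∈C _) A≉0 B≉0 C≉0 x≉0 y≉0 p≉0
                            (≡.subst (_≉ 0#) (pInv-suc O v i) p₊≉0))
  where
  open Geo R
  open InscribedCornerInvariants R
  open OnNondegenerateConic Q Q-sym detQ≉0 O O∈C
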